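{- Let $(\mathscr{L},W)$ be a logical structure with $W$ a $q$-consequence operator. For $\Sigma\subseteq\mathscr{L}$ define $\mu_\Sigma:\mathscr{L}\to\{0,1,2\}$ by $\mu_\Sigma(\beta)=0$ if $\beta\notin W(\Sigma)\cup\Sigma$, $1$ if $\beta\in W(\Sigma)$, and $2$ if $\beta\in(W(\Sigma)\cup\Sigma)\setminus W(\Sigma)$. Let $\mathbf{M}=\{\mu_\Sigma:\Sigma\subseteq\mathscr{L}\}$, and for $m\in\mathbf{M}$, $\Gamma\subseteq\mathscr{L}$ let $m\models_1\Gamma$ iff $m(\Gamma)\subseteq\{1,2\}$ and $m\models_2\Gamma$ iff $m(\Gamma)\subseteq\{1\}$. Let $\mathfrak{S}=(\mathbf{M},\models_1,\models_2,S_q,\mathcal{P}(\mathscr{L}))$ with $S_q=\{(\models_1,\models_2)\}$. Then $W=W_{\mathfrak{S}}$.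
   Context: A logical structure is a pair $(\mathscr{L},W)$ with $W:\mathcal{P}(\mathscr{L})\to\mathcal{P}(\mathscr{L})$. $W$ is a $q$-consequence operator if $\Gamma\subseteq\Sigma$ implies $W(\Gamma)\subseteq W(\Sigma)$ and $W(W(\Gamma)\cup\Gamma)=W(\Gamma)$ for all $\Gamma$. $W_{\mathfrak{S}}$ is defined by: $\alpha\in W_{\mathfrak{S}}(\Gamma)$ iff for all $m\in\mathbf{M}$, $m\models_1\Gamma$ implies $m\models_2\{\alpha\}$. -}

module Defs where

open import Level using (Level)
open import Data.Bool using (Bool; true; false; _∨_; _∧_; not)
open import Data.Product using (_×_; Σ; ∃)
open import Data.Sum using (_⊎_)
open import Relation.Binary.PropositionalEquality using (_≡_)

-- Subsets of 𝓛 are characteristic functions 𝓛 → Bool (the classical power set 𝒫(𝓛)).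
Subset : ∀ {ℓ} → Set ℓ → Set ℓ
Subset L = L → Bool

module _ {ℓ : Level} {L : Set ℓ} where

  _∈_ : L → Subset L → Set
  x ∈ A = A x ≡ true

  _⊆_ : Subset L → Subset L → Set ℓ
  A ⊆ B = ∀ x → x ∈ A → x ∈ B

  _≐_ : Subset L → Subset L → Set ℓ
  A ≐ B = (A ⊆ B) × (B ⊆ A)

  _∪_ : Subset L → Subset L → Subset L
  (A ∪ B) x = A x ∨ B x

  record IsQConsequence (W : Subset L → Subset L) : Set ℓ where
    field
      monotone : ∀ Γ Σ' → Γ ⊆ Σ' → W Γ ⊆ W Σ'
      q-idem   : ∀ Γ → W (W Γ ∪ Γ) ≐ W Γ

data Val : Set where
  v0 v1 v2 : Val

module _ {ℓ : Level} {L : Set ℓ} (W : Subset L → Subset L) where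

  μ : Subset L → L → Val
  μ Σ' β with W Σ' β | Σ' β
  ... | true  | _     = v1
  ... | false | true  = v2
  ... | false | false = v0

  Model : Set ℓ
  Model = L → Val

  IsInM : Model → Set ℓ
  IsInM m = ∃ λ Σ' → m ≡ μ Σ'

  _⊨₁_ : Model → Subset L → Set ℓ
  m ⊨₁ Γ = ∀ β → β ∈ Γ → (m β ≡ v1 ⊎ m β ≡ v2)

  _⊨₂_ : Model → Subset L → Set ℓ
  m ⊨₂ Γ = ∀ β → β ∈ Γ → m β ≡ v1

  -- ⊨₂ applied to the singleton {α} (singletons need not be Bool-decidable
  -- without decidable equality on 𝓛, so {α} is taken as the predicate β ≡ α)
  _⊨₂single_ : Model → L → Set ℓ
  m ⊨₂single α = ∀ β → β ≡ α → m β ≡ v1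

  InW𝔖 : Subset L → L → Set ℓ
  InW𝔖 Γ α = ∀ (m : Model) → IsInM m → m ⊨₁ Γ → m ⊨₂single α

-- A model μ_Σ satisfies Γ in the sense of ⊨₁ exactly when Γ ⊆ W(Σ) ∪ Σ, and
-- satisfies {α} in the sense of ⊨₂ exactly when α ∈ W(Σ). Soundness: if α ∈ W(Γ)
-- and Γ ⊆ W(Σ) ∪ Σ, monotonicity and q-idempotence give α ∈ W(W(Σ) ∪ Σ) = W(Σ).
-- Completeness: the canonical model μ_Γ satisfies Γ, so α ∈ W_𝔖(Γ) forces α ∈ W(Γ).
module Submission where

open import Defs
open import Level using (Level)
open import Data.Bool using (true; false)
open import Data.Product using (_×_; _,_; proj₁)
open import Data.Sum using (_⊎_; inj₁; inj₂)
open import Relation.Binary.PropositionalEquality using (_≡_; refl)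

module _ {ℓ : Level} {L : Set ℓ} (W : Subset L → Subset L) where

  μ≡v1⇒∈W : ∀ Σ' β → μ W Σ' β ≡ v1 → β ∈ W Σ'
  μ≡v1⇒∈W Σ' β μβ≡v1 with W Σ' β | Σ' β
  μ≡v1⇒∈W Σ' β refl  | true  | _     = refl
  μ≡v1⇒∈W Σ' β ()    | false | true
  μ≡v1⇒∈W Σ' β ()    | false | false

  ∈W⇒μ≡v1 : ∀ Σ' β → β ∈ W Σ' → μ W Σ' β ≡ v1
  ∈W⇒μ≡v1 Σ' β β∈WΣ with W Σ' β | Σ' β
  ∈W⇒μ≡v1 Σ' β refl | true | _ = refl

  μ≢v0⇒∈W∪ : ∀ Σ' β → μ W Σ' β ≡ v1 ⊎ μ W Σ' β ≡ v2 → β ∈ (W Σ' ∪ Σ')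
  μ≢v0⇒∈W∪ Σ' β μβ with W Σ' β | Σ' β
  μ≢v0⇒∈W∪ Σ' β _        | true  | _     = refl
  μ≢v0⇒∈W∪ Σ' β _        | false | true  = refl
  μ≢v0⇒∈W∪ Σ' β (inj₁ ()) | false | false
  μ≢v0⇒∈W∪ Σ' β (inj₂ ()) | false | false

  ⊨₁⇒⊆W∪ : ∀ Σ' Γ → _⊨₁_ W (μ W Σ') Γ → Γ ⊆ (W Σ' ∪ Σ')
  ⊨₁⇒⊆W∪ Σ' Γ μΣ⊨Γ β β∈Γ = μ≢v0⇒∈W∪ Σ' β (μΣ⊨Γ β β∈Γ)

  μ-⊨₁-self : ∀ Σ' → _⊨₁_ W (μ W Σ') Σ'
  μ-⊨₁-self Σ' β β∈Σ with W Σ' β | Σ' β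
  μ-⊨₁-self Σ' β _    | true  | _    = inj₁ refl
  μ-⊨₁-self Σ' β refl | false | true = inj₂ refl

  W⊆W𝔖 : IsQConsequence W → ∀ Γ α → α ∈ W Γ → InW𝔖 W Γ α
  W⊆W𝔖 isQ Γ α α∈WΓ _ (Σ' , refl) μΣ⊨Γ β refl =
    ∈W⇒μ≡v1 Σ' β (proj₁ (q-idem Σ') β α∈W[W∪])
    where
    open IsQConsequence isQ
    α∈W[W∪] : α ∈ W (W Σ' ∪ Σ')
    α∈W[W∪] = monotone Γ (W Σ' ∪ Σ') (⊨₁⇒⊆W∪ Σ' Γ μΣ⊨Γ) α α∈WΓ

  W𝔖⊆W : ∀ Γ α → InW𝔖 W Γ α → α ∈ W Γ
  W𝔖⊆W Γ α α∈W𝔖Γ = μ≡v1⇒∈W Γ α (α∈W𝔖Γ (μ W Γ) (Γ , refl) (μ-⊨₁-self Γ) α refl)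

mainTheorem11 : ∀ {ℓ : Level} {L : Set ℓ} (W : Subset L → Subset L) → IsQConsequence W →
    ∀ (Γ : Subset L) (α : L) → (α ∈ W Γ → InW𝔖 W Γ α) × (InW𝔖 W Γ α → α ∈ W Γ)
mainTheorem11 W isQ Γ α = W⊆W𝔖 W isQ Γ α , W𝔖⊆W W Γ α
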